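{- Assume $\mathsf{N}_\mathsf{C}=\{A_1,\dots,A_s\}$ and $\mathsf{N}_\mathsf{R}=\{r_1,\dots,r_t\}$ are finite. Let $\phi=\phi(x)$ be an $S5_{\mathit{FOL}}$-formula with one free variable $x$ that is $\approx_k$-invariant. Then $\phi$ is expressible as an $S5^{\mathit{loc}}_{\mathcal{ALC}}$-concept of rank $k$, namely $\phi$ is logically equivalent to $\mathsf{ST}_x\big(\bigvee_{\mathcal{I},w,d\models\phi} C^k_{\mathcal{I},w,d}\big)$, where the disjunction (which is finite) ranges over the normal forms $C^k_{\mathcal{I},w,d}$ of all triples $\mathcal{I},w,d$ satisfying $\phi$.
   Context: An $S5$-interpretation $\mathcal{I}$ consists of nonempty sets $W^\mathcal{I}$ (worlds), $\Delta^\mathcal{I}$ (individuals) and, for each $w\in W^\mathcal{I}$, sets $A^{\mathcal{I},w}\subseteq\Delta^\mathcal{I}$ ($A\in\mathsf{N}_\mathsf{C}$) and relations $r^{\mathcal{I},w}\subseteq\Delta^\mathcal{I}\times\Delta^\mathcal{I}$ ($r\in\mathsf{N}_\mathsf{R}$). $S5^{\mathit{loc}}_{\mathcal{ALC}}$-concepts: $C::=A\mid\neg C\mid C\sqcap D\mid\exists r.C\mid\Box C$ (with $\sqcup$, $\Diamond=\neg\Box\neg$ as abbreviations), $(\exists r.C)^{\mathcal{I},w}=\{d\mid\exists e\in C^{\mathcal{I},w}.(d,e)\in r^{\mathcal{I},w}\}$, $(\Box C)^{\mathcal{I},w}=\{d\mid\forall v\in W^\mathcal{I}.\,d\in C^{\mathcal{I},v}\}$,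 Booleans as usual; rank = maximal nesting depth of $\Box$ and $\exists r$; $\mathcal{I},w,d\models C$ means $d\in C^{\mathcal{I},w}$. $S5_{\mathit{FOL}}$-formulas: $\phi::=R(x_1,\dots,x_n)\mid x=y\mid\neg\phi\mid\phi\sqcap\psi\mid\exists x.\phi\mid\Box\phi$ over unary predicates $A_i$ and binary predicates $r_j$, evaluated at a world $w$ in the usual first-order way at $w$, with $\Box\phi$ true iff $\phi$ holds at all worlds. Standard translation: $\mathsf{ST}_x(A)=A(x)$, $\mathsf{ST}_x(\exists r.C)=\exists y.(r(x,y)\sqcap\mathsf{ST}_y(C))$ ($y$ fresh), commuting with all other constructs. Normal forms: $\mathsf{nf}_{ -1}=\emptyset$; $\mathsf{at}_k=\{A_1,\dots,A_s\}\cup\{\exists r_i.C\mid 1\le i\le t,\ C\in\mathsf{nf}_{k-1}\}\cup\{\Diamond C\mid C\in\mathsf{nf}_{k-1}\}$, and $\mathsf{nf}_k$ is the set of conjunctions $\bigwedge_{B\in\mathsf{at}_k}\varepsilon_BB$ (in a fixed order), each $\varepsilon_B$ being nothing or negation. $C^k_{\mathcal{I},w,d}$ denotes the unique element of $\mathsf{nf}_k$ satisfied by $\mathcal{I},w,d$. $n$-round bisimulation game for $\mathcal{I},w_0,d_0$ and $\mathcal{J},v_0,e_0$: configurations $((w,d),(v,e))$, initially $((w_0,d_0),(v_0,e_0))$; in each of at most $n$ rounds, $S$ either picks $w'\in W^\mathcal{I}$ and $D$ picks $v'\in W^\mathcal{J}$ (new configuration $((w',d),(v',e))$) or symmetrically;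 or $S$ picks $r$ and $d'$ with $(d,d')\in r^{\mathcal{I},w}$ and $D$ picks $e'$ with $(e,e')\in r^{\mathcal{J},v}$ (new configuration $((w,d'),(v,e'))$) or symmetrically. A player unable to move loses; $S$ wins upon reaching a configuration where some concept name holds at $(w,d)$ in $\mathcal{I}$ but not at $(v,e)$ in $\mathcal{J}$ or vice versa; otherwise $D$ wins. $\mathcal{I},w,d\approx_n\mathcal{J},v,e$ iff $D$ has a winning strategy. $\phi(x)$ is $\approx_k$-invariant if $\mathcal{I},w,d\approx_k\mathcal{J},v,e$ implies ($\mathcal{I},w,d\models\phi$ iff $\mathcal{J},v,e\models\phi$). -}

module Defs where

open import Level using (0ℓ)
open import Data.Nat using (ℕ; zero; suc)
open import Data.Fin using (Fin; zero; suc)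
open import Data.Bool using (Bool)
open import Data.List using (List; []; _∷_; _++_; map; concatMap; allFin)
open import Data.List.Membership.Propositional using (_∈_)
open import Data.Product using (Σ; _×_; _,_)
open import Data.Empty using (⊥)
open import Relation.Nullary using (¬_; Dec)
open import Relation.Binary.PropositionalEquality using (_≡_)
open import Function.Bundles using (_⇔_)

-- Classical metatheory (the paper's ambient logic), supplied as a hypothesis.
ExcludedMiddle : Set₂
ExcludedMiddle = (P : Set₁) → Dec P

-- Signature: N_C = {A_1..A_s} (indices Fin s), N_R = {r_1..r_t} (indices Fin t).
module _ (s t : ℕ) where

  -- S5-interpretations (constant domain Δ, world set W)
  record Interp : Set₁ where
    field
      W    : Set
      Δ    : Set
      conc : Fin s → W → Δ → Set
      role : Fin t → W → Δ → Δ → Set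

  -- S5^loc_ALC concepts
  -- ⊤ is included only to denote the empty conjunction.
  data Concept : Set where
    ⊤c   : Concept
    atom : Fin s → Concept
    ¬c_  : Concept → Concept
    _⊓_  : Concept → Concept → Concept
    ∃r   : Fin t → Concept → Concept
    □_   : Concept → Concept

  ⊥c : Concept
  ⊥c = ¬c ⊤c

  _⊔_ : Concept → Concept → Concept
  C ⊔ D = ¬c ((¬c C) ⊓ (¬c D))

  ◇_ : Concept → Concept
  ◇ C = ¬c (□ (¬c C))

  Sat : (I : Interp) → Interp.W I → Interp.Δ I → Concept → Set
  Sat I w d ⊤c       = Data.Unit.⊤ where import Data.Unit
  Sat I w d (atom i) = Interp.conc I i w d
  Sat I w d (¬c C)   = ¬ Sat I w d C
  Sat I w d (C ⊓ D)  = Sat I w d C × Sat I w d D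
  Sat I w d (∃r j C) = Σ (Interp.Δ I) λ e → Interp.role I j w d e × Sat I w e C
  Sat I w d (□ C)    = (v : Interp.W I) → Sat I v d C

  data Formula (n : ℕ) : Set where
    A    : Fin s → Fin n → Formula n
    r    : Fin t → Fin n → Fin n → Formula n
    _≐_  : Fin n → Fin n → Formula n
    ¬f_  : Formula n → Formula n
    _∧_  : Formula n → Formula n → Formula n
    ∃f   : Formula (suc n) → Formula n        -- binds variable zero
    □f_  : Formula n → Formula n

  extend : {n : ℕ} {D : Set} → (Fin n → D) → D → Fin (suc n) → D
  extend ρ d zero    = d
  extend ρ d (suc i) = ρ i

  Holds : (I : Interp) {n : ℕ} → Interp.W I → (Fin n → Interp.Δ I) → Formula n → Set
  Holds I w ρ (A i x)   = Interp.conc I i w (ρ x)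
  Holds I w ρ (r j x y) = Interp.role I j w (ρ x) (ρ y)
  Holds I w ρ (x ≐ y)   = ρ x ≡ ρ y
  Holds I w ρ (¬f φ)    = ¬ Holds I w ρ φ
  Holds I w ρ (φ ∧ ψ)   = Holds I w ρ φ × Holds I w ρ ψ
  Holds I w ρ (∃f φ)    = Σ (Interp.Δ I) λ e → Holds I w (extend ρ e) φ
  Holds I w ρ (□f φ)    = (v : Interp.W I) → Holds I v ρ φ

  Holds₁ : (I : Interp) → Interp.W I → Interp.Δ I → Formula 1 → Set
  Holds₁ I w d φ = Holds I w (λ _ → d) φ

  -- Standard translation ST_x : the free variable x is zero,
  -- the fresh variable y for ∃r is the newly bound variable zero.
  ST : {n : ℕ} → Concept → Formula (suc n)
  ST ⊤c       = zero ≐ zero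
  ST (atom i) = A i zero
  ST (¬c C)   = ¬f ST C
  ST (C ⊓ D)  = ST C ∧ ST D
  ST (∃r j C) = ∃f (r j (suc zero) zero ∧ ST C)
  ST (□ C)    = □f ST C

  -- n-round bisimulation game: D has a winning strategy from
  -- configuration ((w,d),(v,e)) with n rounds left.
  AtomAgree : (I J : Interp) → Interp.W I → Interp.Δ I → Interp.W J → Interp.Δ J → Set
  AtomAgree I J w d v e = (i : Fin s) → Interp.conc I i w d ⇔ Interp.conc J i v e

  DWins : ℕ → (I J : Interp) → Interp.W I → Interp.Δ I → Interp.W J → Interp.Δ J → Set
  DWins zero    I J w d v e = AtomAgree I J w d v e
  DWins (suc n) I J w d v e =
    AtomAgree I J w d v e ×
    ((w' : Interp.W I) → Σ (Interp.W J) λ v' → DWins n I J w' d v' e) ×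
    ((v' : Interp.W J) → Σ (Interp.W I) λ w' → DWins n I J w' d v' e) ×
    ((j : Fin t) (d' : Interp.Δ I) → Interp.role I j w d d' →
        Σ (Interp.Δ J) λ e' → Interp.role J j v e e' × DWins n I J w d' v e') ×
    ((j : Fin t) (e' : Interp.Δ J) → Interp.role J j v e e' →
        Σ (Interp.Δ I) λ d' → Interp.role I j w d d' × DWins n I J w d' v e')

  Bisim : ℕ → (I : Interp) → Interp.W I → Interp.Δ I →
          (J : Interp) → Interp.W J → Interp.Δ J → Set
  Bisim n I w d J v e = DWins n I J w d v e

  Invariant : ℕ → Formula 1 → Set₁
  Invariant k φ = (I J : Interp) (w : Interp.W I) (d : Interp.Δ I)
                  (v : Interp.W J) (e : Interp.Δ J) →
                  Bisim k I w d J v e → (Holds₁ I w d φ ⇔ Holds₁ J v e φ)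

  -- Normal forms.  nfS 0 = nf_{-1} = ∅ ,  nfS (suc k) = nf_k.
  -- at_k built from nf_{k-1}, in a fixed order
  atoms : List Concept → List Concept
  atoms prev = map atom (allFin s)
            ++ concatMap (λ j → map (∃r j) prev) (allFin t)
            ++ map ◇_ prev

  signings : List Concept → List (List Concept)
  signings []       = [] ∷ []
  signings (B ∷ Bs) = concatMap (λ l → (B ∷ l) ∷ ((¬c B) ∷ l) ∷ []) (signings Bs)

  ⋀ : List Concept → Concept
  ⋀ []           = ⊤c
  ⋀ (B ∷ [])     = B
  ⋀ (B ∷ B' ∷ Bs) = B ⊓ ⋀ (B' ∷ Bs)

  ⋁ : List Concept → Concept
  ⋁ []           = ⊥c
  ⋁ (C ∷ [])     = C
  ⋁ (C ∷ C' ∷ Cs) = C ⊔ ⋁ (C' ∷ Cs)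

  nfS : ℕ → List Concept
  nfS zero    = []
  nfS (suc k) = map ⋀ (signings (atoms (nfS k)))

  at : ℕ → List Concept
  at k = atoms (nfS k)

  nf : ℕ → List Concept
  nf k = nfS (suc k)

  -- C is the normal form C^k_{I,w,d}: the (unique) element of nf_k satisfied by I,w,d
  IsNF : (k : ℕ) (I : Interp) → Interp.W I → Interp.Δ I → Concept → Set
  IsNF k I w d C = (C ∈ nf k) × Sat I w d C

  NFsOf : ℕ → Formula 1 → List Concept → Set₁
  NFsOf k φ L = (C : Concept) →
    (C ∈ L) ⇔ (Σ Interp λ I → Σ (Interp.W I) λ w → Σ (Interp.Δ I) λ d →
                  Holds₁ I w d φ × IsNF k I w d C)

module Submission where

-- The proof rests on one semantic fact about normal forms (nf-bisim): if two
-- pointed S5-interpretations satisfy the same element of nf_k, then D wins the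
-- k-round bisimulation game between them.  A normal form fixes the truth value
-- of every atom of at_k (signing-covers, nf-agree); the atoms ∃r.C′ and ◇C′ with
-- C′ ∈ nf_{k-1} let D copy each move of S into a position satisfying the same
-- normal form of rank k-1, because every point has a normal form of every rank
-- (nf-exists).  The theorem then follows:
--   * φ ⇒ ST(⋁ L): the normal form of a model of φ is one of the disjuncts;
--   * ST(⋁ L) ⇒ φ: a satisfied disjunct is the normal form of some model of φ,
--     which is ≈ₖ-bisimilar to the current point by nf-bisim, and φ is invariant.
-- The standard translation is correct (ST-correct), and the list L exists since
-- nf_k is finite and can be filtered by the (classically decided) property of
-- being the normal form of a model of φ.

open import Defs
open import Level using (Lift; lift; lower)
open import Data.Nat using (ℕ; zero; suc)
open import Data.Fin using (Fin; zero)
open import Data.Unit using (tt)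
open import Data.Empty using (⊥-elim)
open import Data.Sum using (_⊎_; inj₁; inj₂)
open import Data.List using (List; []; _∷_; map; concatMap; allFin; filter)
open import Data.List.Relation.Unary.Any using (here; there)
open import Data.List.Membership.Propositional using (_∈_; find; lose)
open import Data.List.Membership.Propositional.Properties
  using (∈-map⁺; ∈-map⁻; ∈-++⁺ˡ; ∈-++⁺ʳ; ∈-concatMap⁺; ∈-concatMap⁻; ∈-allFin; ∈-filter⁺; ∈-filter⁻)
open import Data.Product using (Σ; _×_; _,_; proj₂)
open import Relation.Nullary using (¬_; Dec; yes; no)
open import Relation.Nullary.Decidable using (map′; decidable-stable)
open import Relation.Binary.PropositionalEquality using (refl)
open import Function.Bundles using (_⇔_; mk⇔; Equivalence)

open Equivalence

module Constructive (s t : ℕ) where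

  ST-correct : ∀ {n} (C : Concept s t) (I : Interp s t) (w : Interp.W I)
               (ρ : Fin (suc n) → Interp.Δ I) →
               Holds s t I w ρ (ST s t C) ⇔ Sat s t I w (ρ zero) C
  ST-correct ⊤c       I w ρ = mk⇔ (λ _ → tt) (λ _ → refl)
  ST-correct (atom i) I w ρ = mk⇔ (λ a → a) (λ a → a)
  ST-correct (¬c C)   I w ρ =
    mk⇔ (λ h c → h (from (ST-correct C I w ρ) c)) (λ h c → h (to (ST-correct C I w ρ) c))
  ST-correct (C ⊓ D)  I w ρ =
    mk⇔ (λ (c , d) → to (ST-correct C I w ρ) c , to (ST-correct D I w ρ) d)
        (λ (c , d) → from (ST-correct C I w ρ) c , from (ST-correct D I w ρ) d)
  ST-correct (∃r j C) I w ρ =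
    mk⇔ (λ (e , edge , c) → e , edge , to (ST-correct C I w (extend s t ρ e)) c)
        (λ (e , edge , c) → e , edge , from (ST-correct C I w (extend s t ρ e)) c)
  ST-correct (□ C)    I w ρ =
    mk⇔ (λ h v → to (ST-correct C I v ρ) (h v)) (λ h v → from (ST-correct C I v ρ) (h v))

  module _ {I : Interp s t} {w : Interp.W I} {d : Interp.Δ I} where

    ⋁-intro : (L : List (Concept s t)) {C : Concept s t} →
              C ∈ L → Sat s t I w d C → Sat s t I w d (⋁ s t L)
    ⋁-intro (C ∷ [])      (here refl) c = c
    ⋁-intro (C ∷ C′ ∷ Cs) (here refl) c = λ (¬C , _) → ¬C c
    ⋁-intro (C ∷ C′ ∷ Cs) (there C∈)  c = λ (_ , ¬rest) → ¬rest (⋁-intro (C′ ∷ Cs) C∈ c)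

    ⋁-none : (L : List (Concept s t)) →
             (∀ {C} → C ∈ L → ¬ Sat s t I w d C) → ¬ Sat s t I w d (⋁ s t L)
    ⋁-none []            none h = h tt
    ⋁-none (C ∷ [])      none h = none (here refl) h
    ⋁-none (C ∷ C′ ∷ Cs) none h = h (none (here refl) , ⋁-none (C′ ∷ Cs) (λ C∈ → none (there C∈)))

    ⋀-cons : (B : Concept s t) (l : List (Concept s t)) →
             Sat s t I w d B → Sat s t I w d (⋀ s t l) → Sat s t I w d (⋀ s t (B ∷ l))
    ⋀-cons B []      b _ = b
    ⋀-cons B (_ ∷ _) b h = b , h

    ⋀-elim : (l : List (Concept s t)) {B : Concept s t} →
             Sat s t I w d (⋀ s t l) → B ∈ l → Sat s t I w d B
    ⋀-elim (B ∷ [])      h      (here refl) = h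
    ⋀-elim (B ∷ B′ ∷ Bs) (b , _) (here refl) = b
    ⋀-elim (B ∷ B′ ∷ Bs) (_ , h) (there B∈)  = ⋀-elim (B′ ∷ Bs) h B∈

  extensions : Concept s t → List (Concept s t) → List (List (Concept s t))
  extensions B l = (B ∷ l) ∷ ((¬c B) ∷ l) ∷ []

  extensions-keep : {B X : Concept s t} {l l′ : List (Concept s t)} →
                    l ∈ extensions B l′ → X ∈ l′ → X ∈ l
  extensions-keep (here refl)         X∈ = there X∈
  extensions-keep (there (here refl)) X∈ = there X∈

  signing-covers : (Bs : List (Concept s t)) {l : List (Concept s t)} → l ∈ signings s t Bs →
                   {B : Concept s t} → B ∈ Bs → B ∈ l ⊎ (¬c B) ∈ l
  signing-covers (B ∷ Bs) l∈ B′∈ with find (∈-concatMap⁻ (extensions B) {xs = signings s t Bs} l∈)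
  signing-covers (B ∷ Bs) l∈ (here refl) | _ , _ , here refl         = inj₁ (here refl)
  signing-covers (B ∷ Bs) l∈ (here refl) | _ , _ , there (here refl) = inj₂ (here refl)
  signing-covers (B ∷ Bs) l∈ (there B′∈) | l′ , l′∈ , l∈ext with signing-covers Bs l′∈ B′∈
  ... | inj₁ pos = inj₁ (extensions-keep l∈ext pos)
  ... | inj₂ neg = inj₂ (extensions-keep l∈ext neg)

  nf-agree : (k : ℕ) {I J : Interp s t} {w : Interp.W I} {d : Interp.Δ I}
             {v : Interp.W J} {e : Interp.Δ J} {C : Concept s t} → C ∈ nf s t k →
             Sat s t I w d C → Sat s t J v e C →
             {B : Concept s t} → B ∈ at s t k → Sat s t I w d B ⇔ Sat s t J v e B
  nf-agree k C∈ c₁ c₂ B∈ with ∈-map⁻ (⋀ s t) C∈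
  ... | l , l∈ , refl with signing-covers (at s t k) l∈ B∈
  ...   | inj₁ pos = mk⇔ (λ _ → ⋀-elim l c₂ pos) (λ _ → ⋀-elim l c₁ pos)
  ...   | inj₂ neg = mk⇔ (λ b → ⊥-elim (⋀-elim l c₁ neg b)) (λ b → ⊥-elim (⋀-elim l c₂ neg b))

  atom∈at : (k : ℕ) (i : Fin s) → atom i ∈ at s t k
  atom∈at k i = ∈-++⁺ˡ (∈-map⁺ atom (∈-allFin i))

  ∃r∈at : (k : ℕ) (j : Fin t) {C : Concept s t} → C ∈ nfS s t k → ∃r j C ∈ at s t k
  ∃r∈at k j C∈ = ∈-++⁺ʳ (map atom (allFin s))
    (∈-++⁺ˡ (∈-concatMap⁺ (λ j → map (∃r j) (nfS s t k)) (lose (∈-allFin j) (∈-map⁺ (∃r j) C∈))))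

  ◇∈at : (k : ℕ) {C : Concept s t} → C ∈ nfS s t k → (◇_ s t C) ∈ at s t k
  ◇∈at k C∈ = ∈-++⁺ʳ (map atom (allFin s))
    (∈-++⁺ʳ (concatMap (λ j → map (∃r j) (nfS s t k)) (allFin t)) (∈-map⁺ (◇_ s t) C∈))

module Classical (em : ExcludedMiddle) (s t : ℕ) where

  open Constructive s t

  decide : (P : Set) → Dec P
  decide P = map′ lower lift (em (Lift _ P))

  double-negation : {P : Set} → ¬ ¬ P → P
  double-negation {P} = decidable-stable (decide P)

  ◇-witness : {W : Set} {P : W → Set} → ¬ ((u : W) → ¬ P u) → Σ W P
  ◇-witness none = double-negation (λ ¬Σ → none (λ u p → ¬Σ (u , p)))

  ⋁-elim : {I : Interp s t} {w : Interp.W I} {d : Interp.Δ I} (L : List (Concept s t)) →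
           Sat s t I w d (⋁ s t L) → Σ (Concept s t) λ C → C ∈ L × Sat s t I w d C
  ⋁-elim L h = double-negation (λ ¬Σ → ⋁-none L (λ C∈ c → ¬Σ (_ , C∈ , c)) h)

  signing-exists : (I : Interp s t) (w : Interp.W I) (d : Interp.Δ I) (Bs : List (Concept s t)) →
                   Σ (List (Concept s t)) λ l → l ∈ signings s t Bs × Sat s t I w d (⋀ s t l)
  signing-exists I w d []       = [] , here refl , tt
  signing-exists I w d (B ∷ Bs) with signing-exists I w d Bs | decide (Sat s t I w d B)
  ... | l , l∈ , h | yes b =
    B ∷ l , ∈-concatMap⁺ (extensions B) (lose l∈ (here refl)) , ⋀-cons B l b h
  ... | l , l∈ , h | no ¬b =
    (¬c B) ∷ l , ∈-concatMap⁺ (extensions B) (lose l∈ (there (here refl))) , ⋀-cons (¬c B) l ¬b h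

  nf-exists : (k : ℕ) (I : Interp s t) (w : Interp.W I) (d : Interp.Δ I) →
              Σ (Concept s t) λ C → C ∈ nf s t k × Sat s t I w d C
  nf-exists k I w d with signing-exists I w d (at s t k)
  ... | l , l∈ , h = ⋀ s t l , ∈-map⁺ (⋀ s t) l∈ , h

  -- Points sharing a normal form of rank k are ≈ₖ-bisimilar: D answers each move
  -- with a position having the same normal form of rank k-1, which exists since
  -- both points agree on the atoms ◇C′ and ∃r.C′ of at_k.
  nf-bisim : (k : ℕ) {I J : Interp s t} {w : Interp.W I} {d : Interp.Δ I}
             {v : Interp.W J} {e : Interp.Δ J} {C : Concept s t} → C ∈ nf s t k →
             Sat s t I w d C → Sat s t J v e C → Bisim s t k I w d J v e
  nf-bisim zero    C∈ c₁ c₂ = λ i → nf-agree zero C∈ c₁ c₂ (atom∈at zero i)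
  nf-bisim (suc k) {I} {J} {w} {d} {v} {e} C∈ c₁ c₂ =
    (λ i → agree (atom∈at (suc k) i)) ,
    (λ w′ → let (C′ , C′∈ , c′) = nf-exists k I w′ d
                (v′ , c″)       = ◇-witness (to (agree (◇∈at (suc k) C′∈)) (λ ¬C → ¬C w′ c′))
            in v′ , nf-bisim k C′∈ c′ c″) ,
    (λ v′ → let (C′ , C′∈ , c′) = nf-exists k J v′ e
                (w′ , c″)       = ◇-witness (from (agree (◇∈at (suc k) C′∈)) (λ ¬C → ¬C v′ c′))
            in w′ , nf-bisim k C′∈ c″ c′) ,
    (λ j d′ edge → let (C′ , C′∈ , c′)  = nf-exists k I w d′
                       (e′ , edge′ , c″) = to (agree (∃r∈at (suc k) j C′∈)) (d′ , edge , c′)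
                   in e′ , edge′ , nf-bisim k C′∈ c′ c″) ,
    (λ j e′ edge → let (C′ , C′∈ , c′)  = nf-exists k J v e′
                       (d′ , edge′ , c″) = from (agree (∃r∈at (suc k) j C′∈)) (e′ , edge , c′)
                   in d′ , edge′ , nf-bisim k C′∈ c″ c′)
    where
      agree : ∀ {B} → B ∈ at s t (suc k) → Sat s t I w d B ⇔ Sat s t J v e B
      agree = nf-agree (suc k) C∈ c₁ c₂

  NFsOf-exists : (k : ℕ) (φ : Formula s t 1) → Σ (List (Concept s t)) (NFsOf s t k φ)
  NFsOf-exists k φ = filter model? (nf s t k) ,
    λ C → mk⇔ (λ C∈ → proj₂ (∈-filter⁻ model? {xs = nf s t k} C∈))
              (λ model@(_ , _ , _ , _ , C∈ , _) → ∈-filter⁺ model? C∈ model)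
    where
      NFOfModel : Concept s t → Set₁
      NFOfModel C = Σ (Interp s t) λ I → Σ (Interp.W I) λ w → Σ (Interp.Δ I) λ d →
                    Holds₁ s t I w d φ × IsNF s t k I w d C

      model? : (C : Concept s t) → Dec (NFOfModel C)
      model? C = em (NFOfModel C)

  invariant⇒nf-disjunction : (k : ℕ) (φ : Formula s t 1) → Invariant s t k φ →
    (L : List (Concept s t)) → NFsOf s t k φ L →
    (I : Interp s t) (w : Interp.W I) (d : Interp.Δ I) →
    Holds₁ s t I w d φ ⇔ Holds₁ s t I w d (ST s t (⋁ s t L))
  invariant⇒nf-disjunction k φ invariant L L-spec I w d = mk⇔ model⇒disjunction disjunction⇒model
    where
      translation : Holds₁ s t I w d (ST s t (⋁ s t L)) ⇔ Sat s t I w d (⋁ s t L)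
      translation = ST-correct (⋁ s t L) I w (λ _ → d)

      model⇒disjunction : Holds₁ s t I w d φ → Holds₁ s t I w d (ST s t (⋁ s t L))
      model⇒disjunction h with nf-exists k I w d
      ... | C , C∈ , c = from translation (⋁-intro L (from (L-spec C) (I , w , d , h , C∈ , c)) c)

      disjunction⇒model : Holds₁ s t I w d (ST s t (⋁ s t L)) → Holds₁ s t I w d φ
      disjunction⇒model h with ⋁-elim L (to translation h)
      ... | C , C∈L , c with to (L-spec C) C∈L
      ...   | J , v , e , hJ , C∈ , c′ = from (invariant I J w d v e (nf-bisim k C∈ c c′)) hJ

lemma23 : ExcludedMiddle → (s t k : ℕ) (φ : Formula s t 1) → Invariant s t k φ →
    Σ (List (Concept s t)) (λ L → NFsOf s t k φ L)
    × ((L : List (Concept s t)) → NFsOf s t k φ L →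
        (I : Interp s t) (w : Interp.W I) (d : Interp.Δ I) →
        Holds₁ s t I w d φ ⇔ Holds₁ s t I w d (ST s t (⋁ s t L)))
lemma23 em s t k φ invariant =
  NFsOf-exists k φ , invariant⇒nf-disjunction k φ invariant
  where open Classical em s t
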